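{- For all formulas $\phi,\psi,\chi$ of $\mathcal{L}(W)$, the formula $W\psi\land W(\phi\land\psi)\to W\big((W\chi\to W(\phi\land\chi))\land\psi\big)$ is valid on the class of Euclidean frames.
   Context: Fix a nonempty set $\mathbf{P}$ of propositional variables. $\mathcal{L}(W)$: $\phi::=p\mid\neg\phi\mid(\phi\land\phi)\mid W\phi$ ($p\in\mathbf{P}$), other connectives as usual. A frame is $(S,R)$, $S\neq\emptyset$, $R\subseteq S\times S$; a model based on it adds $V:\mathbf{P}\to2^S$. Truth: Boolean clauses as usual; $\mathcal{M},s\vDash W\phi$ iff $\mathcal{M},s\nvDash\phi$ and $\mathcal{M},t\vDash\phi$ for all $t$ with $sRt$. A frame is Euclidean if $sRt$ and $sRu$ imply $tRu$. A formula is valid on a class of frames if it is true at every state of every model based on a frame in the class. -}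

module Defs where

open import Data.Product using (_×_; Σ)
open import Data.Empty using (⊥)
open import Relation.Nullary using (¬_)
open import Level using (Level; _⊔_; suc)

data Form (P : Set) : Set where
  var  : P → Form P
  ¬ᶠ_  : Form P → Form P
  _∧ᶠ_ : Form P → Form P → Form P
  W    : Form P → Form P

infixr 6 _∧ᶠ_
infixr 4 _⇒ᶠ_

_⇒ᶠ_ : {P : Set} → Form P → Form P → Form P
φ ⇒ᶠ ψ = ¬ᶠ (φ ∧ᶠ ¬ᶠ ψ)

record Frame : Set₁ where
  field
    S  : Set
    s₀ : S            -- witnesses S ≠ ∅
    R  : S → S → Set

record Model (P : Set) : Set₁ where
  field
    frame : Frame
  open Frame frame public
  field
    V : P → S → Set

module _ {P : Set} (M : Model P) where
  open Model M
  _⊨_ : S → Form P → Set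
  s ⊨ var p    = V p s
  s ⊨ (¬ᶠ φ)   = ¬ (s ⊨ φ)
  s ⊨ (φ ∧ᶠ ψ) = (s ⊨ φ) × (s ⊨ ψ)
  s ⊨ W φ      = ¬ (s ⊨ φ) × (∀ t → R s t → t ⊨ φ)

Euclidean : Frame → Set
Euclidean F = ∀ {s t u} → R s t → R s u → R t u
  where open Frame F

ValidOn : {P : Set} → (Frame → Set) → Form P → Set₁
ValidOn {P} C φ = (F : Frame) → C F → (V : P → Frame.S F → Set) →
  (s : Frame.S F) → _⊨_ (record { frame = F ; V = V }) s φ

-- Every successor of a state
-- in a Euclidean frame is reflexive, and W-formulas are false at reflexive states,
-- so at every successor the implication Wχ → W(φ ∧ χ) holds vacuously, while ψ
-- holds there and fails at the current state.
module Submission where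

open import Defs
open import Data.Empty using (⊥-elim)
open import Data.Product using (_,_; proj₁; proj₂)
open import Relation.Nullary using (¬_)

euclidean-successor-reflexive : (F : Frame) → Euclidean F →
  ∀ {s t} → Frame.R F s t → Frame.R F t t
euclidean-successor-reflexive F euc st = euc st st

module _ {P : Set} (M : Model P) where
  open Model M

  ⇒ᶠ-intro : ∀ {s} (φ ψ : Form P) → (_⊨_ M s φ → _⊨_ M s ψ) → _⊨_ M s (φ ⇒ᶠ ψ)
  ⇒ᶠ-intro _ _ f (sφ , s¬ψ) = s¬ψ (f sφ)

  W-false-at-reflexive : ∀ {t} (χ : Form P) → R t t → ¬ _⊨_ M t (W χ)
  W-false-at-reflexive χ tt (t¬χ , succχ) = t¬χ (succχ _ tt)

  W-∧-intro : ∀ {s} (θ ψ : Form P) → _⊨_ M s (W ψ) →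
    (∀ t → R s t → _⊨_ M t θ) → _⊨_ M s (W (θ ∧ᶠ ψ))
  W-∧-intro _ _ (s¬ψ , succψ) succθ =
    (λ sθψ → s¬ψ (proj₂ sθψ)) , λ t st → succθ t st , succψ t st

mainTheorem20 : (P : Set) → P → (φ ψ χ : Form P) →
    ValidOn Euclidean ((W ψ ∧ᶠ W (φ ∧ᶠ ψ)) ⇒ᶠ W ((W χ ⇒ᶠ W (φ ∧ᶠ χ)) ∧ᶠ ψ))
mainTheorem20 P _ φ ψ χ F euc V s =
  ⇒ᶠ-intro M (W ψ ∧ᶠ W (φ ∧ᶠ ψ)) (W (θ ∧ᶠ ψ)) λ premises →
    W-∧-intro M θ ψ (proj₁ premises) λ t st →
      ⇒ᶠ-intro M (W χ) (W (φ ∧ᶠ χ)) λ tWχ →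
        ⊥-elim (W-false-at-reflexive M χ (euclidean-successor-reflexive F euc st) tWχ)
  where
  M : Model P
  M = record { frame = F ; V = V }

  θ : Form P
  θ = W χ ⇒ᶠ W (φ ∧ᶠ χ)
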